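{- Let $k\ge1$ and $n\ge1$. The set $\mathcal{B}_n(k+1)$ of $(k+1)$-bundled increasing trees of order $n$ is in bijection with the set $\overline{\mathcal{Q}}_n(k)$ of $k$-bundled Stirling permutations of order $n$.
   Context: A $k$-bundled Stirling permutation of order $n$ is a permutation of the multiset $\{1^k,2^{k+2},\dots,n^{k+2}\}$ (the value $1$ occurring $k$ times and each of $2,\dots,n$ occurring $k+2$ times) such that for each $i$ every entry occurring between two occurrences of $i$ is at least $i$. A $(k+1)$-bundled increasing tree of order $n$ is a rooted tree with vertex set $\{1,\dots,n\}$, root $1$, labels increasing along every path away from the root, in which every vertex has $k+1$ ordered bundles (positions $1,\dots,k+1$), each bundle containing a (possibly empty) linearly ordered sequence of children of that vertex; each non-root vertex lies in exactly one bundle of its parent. -}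

module Defs where

open import Data.Nat using (ℕ; zero; suc; _+_; _≤_; _<_)
open import Data.Fin as Fin using (Fin)
open import Data.List using (List; []; _∷_; _++_; replicate; concatMap; map; upTo; length; lookup)
open import Data.Vec using (Vec; []; _∷_)
open import Data.Product using (Σ; _×_; proj₁)
open import Data.Unit using (⊤)
open import Relation.Binary.Bundles using (Setoid)
open import Relation.Binary.PropositionalEquality using (_≡_; setoid)
open import Relation.Binary.Construct.On as On using ()
open import Data.List.Relation.Binary.Permutation.Propositional using (_↭_)

oneTo : ℕ → List ℕ
oneTo n = map suc (upTo n)

twoTo : ℕ → List ℕ
twoTo zero    = []
twoTo (suc n) = map (λ i → suc (suc i)) (upTo n)

-- Bundled (labelled, plane) trees with b bundles per vertex.
-- A vertex carries a label and b ordered bundles, each bundle an ordered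
-- list of child subtrees.

data BTree (b : ℕ) : Set where
  node : ℕ → Vec (List (BTree b)) b → BTree b

rootLabel : ∀ {b} → BTree b → ℕ
rootLabel (node a _) = a

mutual
  labels : ∀ {b} → BTree b → List ℕ
  labels (node a bs) = a ∷ labelsV bs

  labelsV : ∀ {b m} → Vec (List (BTree b)) m → List ℕ
  labelsV []       = []
  labelsV (l ∷ bs) = labelsL l ++ labelsV bs

  labelsL : ∀ {b} → List (BTree b) → List ℕ
  labelsL []       = []
  labelsL (t ∷ ts) = labels t ++ labelsL ts

mutual
  Increasing : ∀ {b} → BTree b → Set
  Increasing (node a bs) = IncreasingV a bs

  IncreasingV : ∀ {b m} → ℕ → Vec (List (BTree b)) m → Set
  IncreasingV a []       = ⊤
  IncreasingV a (l ∷ bs) = IncreasingL a l × IncreasingV a bs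

  IncreasingL : ∀ {b} → ℕ → List (BTree b) → Set
  IncreasingL a []       = ⊤
  IncreasingL a (t ∷ ts) = (a < rootLabel t) × Increasing t × IncreasingL a ts

IsBundledIncreasingTree : (b n : ℕ) → BTree b → Set
IsBundledIncreasingTree b n t = (labels t ↭ oneTo n) × (rootLabel t ≡ 1) × Increasing t

BundledIncreasingTrees : (b n : ℕ) → Setoid _ _
BundledIncreasingTrees b n =
  On.setoid {B = Σ (BTree b) (IsBundledIncreasingTree b n)} (setoid (BTree b)) proj₁

stirlingMultiset : (k n : ℕ) → List ℕ
stirlingMultiset k n = replicate k 1 ++ concatMap (λ i → replicate (k + 2) i) (twoTo n)

StirlingCondition : List ℕ → Set
StirlingCondition w =
  (p q r : Fin (length w)) → p Fin.< q → q Fin.< r →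
  lookup w p ≡ lookup w r → lookup w p ≤ lookup w q

IsBundledStirling : (k n : ℕ) → List ℕ → Set
IsBundledStirling k n w = (w ↭ stirlingMultiset k n) × StirlingCondition w

BundledStirlingPerms : (k n : ℕ) → Setoid _ _
BundledStirlingPerms k n =
  On.setoid {B = Σ (List ℕ) (IsBundledStirling k n)} (setoid (List ℕ)) proj₁

module Submission where

-- Both families are built one label at a time by inserting the new maximum
-- L = m + 2 into an object of order m + 1:
--   * a (k+1)-bundled increasing tree receives L as a new leaf in one of its
--     gaps (a position inside a bundle, before, between or after children);
--   * a k-bundled Stirling permutation receives a contiguous block of k+2
--     copies of L at one of its positions.
-- In both cases the insertion is invertible (remove the maximum and remember
-- where it sat), and an object of order m + 1 has exactly  slotCount k m  insertion
-- positions, with slotCount k 0 = k + 1 and slotCount k (m+1) = slotCount k m + (k + 2).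

open import Defs
open import Data.Nat using (ℕ; zero; suc; _+_; _∸_; _≤_; _<_; z≤n; s≤s; _≟_; _<?_; pred)
open import Data.List.Membership.DecPropositional _≟_ using (_∈?_)
import Data.Nat.Properties
open import Algebra.Properties.CommutativeSemigroup Data.Nat.Properties.+-commutativeSemigroup
  using (xy∙z≈xz∙y)
open import Data.Empty using (⊥-elim)
open import Data.Fin as Fin using (Fin)
open import Data.List using (List; []; _∷_; _++_; replicate; length; lookup; take; drop;
                             upTo; map; concatMap)
open import Data.List.Membership.Propositional using (_∈_; _∉_)
open import Data.List.Membership.Propositional.Properties using (∈-++⁺ˡ; ∈-++⁺ʳ; ∈-++⁻)
open import Data.List.Properties
  using (++-assoc; ++-identityʳ; take++drop≡id; length-take; length-++; length-replicate;
         upTo-∷ʳ; map-++; concatMap-++)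
open import Data.List.Relation.Binary.Permutation.Propositional
  using (_↭_; ↭-refl; ↭-sym; ↭-trans; ↭-reflexive; ↭-prep; ↭-swap)
open import Data.List.Relation.Binary.Permutation.Propositional.Properties
  using (∈-resp-↭; All-resp-↭; ↭-length; ↭-singleton-inv; shift; shifts; drop-∷; ++-comm)
  renaming (++⁺ˡ to ↭-++⁺ˡ; ++⁺ʳ to ↭-++⁺ʳ)
open import Data.List.Relation.Binary.Sublist.Propositional {A = ℕ}
  using (_⊆_; []; _∷_; _∷ʳ_; minimum; ⊆-refl; ⊆-trans; to∈; from∈)
  renaming (lookup to ∈-resp-⊆)
open import Data.List.Relation.Binary.Sublist.Propositional.Properties using (++⁺; ++⁺ˡ)
open import Data.List.Relation.Unary.All as All using (All; []; _∷_)
import Data.List.Relation.Unary.All.Properties as All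
open import Data.List.Relation.Unary.Any using (here; there; index)
open import Data.List.Relation.Unary.Any.Properties using (lookup-index)
open import Data.Nat.Properties
  using (≤-refl; ≤-reflexive; <-irrefl; <⇒≤; ≤∧≢⇒<; <-≤-trans; ≤⇒≯; ≮⇒≥; m≤m+n;
         m≤n⇒m⊓n≡m; m+n∸m≡n; m+[n∸m]≡n; +-monoʳ-<; +-cancelˡ-<; +-assoc; +-comm; +-suc;
         m<n⇒m<1+n; n<1+n)
open import Data.Product using (Σ; _×_; _,_; proj₁; proj₂)
import Data.Product as Product
open import Data.Sum using ([_,_])
open import Data.Unit using (tt)
open import Data.Vec as Vec using (Vec; []; _∷_)
open import Function using (id; _∘_)
open import Function.Bundles using (Bijection)
open import Relation.Binary.Bundles using (Setoid)
import Relation.Binary.Construct.On as On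
open import Relation.Binary.PropositionalEquality
  using (_≡_; _≢_; refl; sym; trans; cong; cong₂; subst; subst₂; setoid; module ≡-Reasoning)
open import Relation.Nullary using (¬_; yes; no)

-- A growth scheme on X: objects of level m (order m + 1) are exactly those
-- obtained from objects of level m - 1 by inserting the new maximum at one of
-- slots m positions, and  remove  undoes  insert.
record GrowthScheme (X : Set) (slots : ℕ → ℕ) : Set₁ where
  field
    Valid         : ℕ → X → Set
    seed          : X
    seed-valid    : Valid 0 seed
    seed-unique   : ∀ {x} → Valid 0 x → x ≡ seed
    insert        : ℕ → ℕ → X → X
    remove        : ℕ → X → X × ℕ
    insert-valid  : ∀ {m p x} → Valid m x → p < slots m → Valid (suc m) (insert m p x)
    remove-insert : ∀ {m p x} → Valid m x → p < slots m → remove m (insert m p x) ≡ (x , p)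
    remove-valid  : ∀ {m y} → Valid (suc m) y →
                    Valid m (proj₁ (remove m y)) × proj₂ (remove m y) < slots m
    insert-remove : ∀ {m y} → Valid (suc m) y →
                    insert m (proj₂ (remove m y)) (proj₁ (remove m y)) ≡ y

  level : ℕ → Setoid _ _
  level m = On.setoid {B = Σ X (Valid m)} (setoid X) proj₁

open GrowthScheme

private
  variable
    X Y : Set
    slots : ℕ → ℕ

transfer : GrowthScheme X slots → GrowthScheme Y slots → ℕ → X → Y
transfer G H zero    x = seed H
transfer G H (suc m) x =
  insert H m (proj₂ (remove G m x)) (transfer G H m (proj₁ (remove G m x)))

transfer-valid : (G : GrowthScheme X slots) (H : GrowthScheme Y slots) →
                 ∀ m {x} → Valid G m x → Valid H m (transfer G H m x)
transfer-valid G H zero    v = seed-valid H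
transfer-valid G H (suc m) v =
  insert-valid H (transfer-valid G H m (proj₁ (remove-valid G v))) (proj₂ (remove-valid G v))

transfer-inverse : (G : GrowthScheme X slots) (H : GrowthScheme Y slots) →
                   ∀ m {x} → Valid G m x → transfer H G m (transfer G H m x) ≡ x
transfer-inverse G H zero    v = sym (seed-unique G v)
transfer-inverse G H (suc m) {x} v = begin
  transfer H G (suc m) (insert H m p (transfer G H m x′))
    ≡⟨ cong (λ r → insert G m (proj₂ r) (transfer H G m (proj₁ r)))
            (remove-insert H (transfer-valid G H m x′-valid) p<slots) ⟩
  insert G m p (transfer H G m (transfer G H m x′))
    ≡⟨ cong (insert G m p) (transfer-inverse G H m x′-valid) ⟩
  insert G m p x′
    ≡⟨ insert-remove G v ⟩
  x ∎
  where
  open ≡-Reasoning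
  x′ = proj₁ (remove G m x)
  p  = proj₂ (remove G m x)
  x′-valid = proj₁ (remove-valid G v)
  p<slots  = proj₂ (remove-valid G v)

growthBijection : {X Y : Set} {slots : ℕ → ℕ}
                  (G : GrowthScheme X slots) (H : GrowthScheme Y slots) →
                  ∀ m → Bijection (level G m) (level H m)
growthBijection {X} {Y} G H m = record
  { to        = λ (x , v) → transfer G H m x , transfer-valid G H m v
  ; cong      = cong (transfer G H m)
  ; bijective = (λ {x} {y} → injective {x} {y}) , surjective
  }
  where
  injective : ∀ {x y : Σ X (Valid G m)} →
              transfer G H m (proj₁ x) ≡ transfer G H m (proj₁ y) → proj₁ x ≡ proj₁ y
  injective {x , v} {y , w} eq = begin
    x                                   ≡⟨ sym (transfer-inverse G H m v) ⟩
    transfer H G m (transfer G H m x)   ≡⟨ cong (transfer H G m) eq ⟩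
    transfer H G m (transfer G H m y)   ≡⟨ transfer-inverse G H m w ⟩
    y                                   ∎
    where open ≡-Reasoning
  surjective : ∀ (y : Σ Y (Valid H m)) → Σ (Σ X (Valid G m)) λ x →
               ∀ {z : Σ X (Valid G m)} → proj₁ z ≡ proj₁ x → transfer G H m (proj₁ z) ≡ proj₁ y
  surjective (y , w) = (transfer H G m y , transfer-valid H G m w) ,
    λ eq → trans (cong (transfer G H m) eq) (transfer-inverse H G m w)

slotCount : ℕ → ℕ → ℕ
slotCount k zero    = suc k
slotCount k (suc m) = slotCount k m + suc (suc k)

∉-∷ : ∀ {x y : ℕ} {ys} → y ≢ x → x ∉ ys → x ∉ y ∷ ys
∉-∷ y≢x x∉ys (here x≡y)  = y≢x (sym x≡y)
∉-∷ y≢x x∉ys (there x∈) = x∉ys x∈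

∉-++ : ∀ {x : ℕ} xs {ys} → x ∉ xs → x ∉ ys → x ∉ xs ++ ys
∉-++ xs x∉xs x∉ys x∈ = [ x∉xs , x∉ys ] (∈-++⁻ xs x∈)

∈-++-right : ∀ {x : ℕ} xs {ys} → x ∉ xs → x ∈ xs ++ ys → x ∈ ys
∈-++-right xs x∉xs x∈ = [ ⊥-elim ∘ x∉xs , id ] (∈-++⁻ xs x∈)

above-∉ : ∀ {L w} → All (_< L) w → L ∉ w
above-∉ bound L∈w = <-irrefl refl (All.lookup bound L∈w)

Avoids212 : List ℕ → Set
Avoids212 w = ∀ a b → a ∷ b ∷ a ∷ [] ⊆ w → a ≤ b

avoids212-⊆ : ∀ {v w} → v ⊆ w → Avoids212 w → Avoids212 v
avoids212-⊆ v⊆w avoids a b s = avoids a b (⊆-trans s v⊆w)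

entries₁-⊆ : ∀ w (p : Fin (length w)) → lookup w p ∷ [] ⊆ w
entries₁-⊆ (x ∷ w) Fin.zero    = refl ∷ minimum w
entries₁-⊆ (x ∷ w) (Fin.suc p) = x ∷ʳ entries₁-⊆ w p

entries₂-⊆ : ∀ w (p q : Fin (length w)) → p Fin.< q → lookup w p ∷ lookup w q ∷ [] ⊆ w
entries₂-⊆ (x ∷ w) Fin.zero    (Fin.suc q) _         = refl ∷ entries₁-⊆ w q
entries₂-⊆ (x ∷ w) (Fin.suc p) (Fin.suc q) (s≤s p<q) = x ∷ʳ entries₂-⊆ w p q p<q

entries₃-⊆ : ∀ w (p q r : Fin (length w)) → p Fin.< q → q Fin.< r →
             lookup w p ∷ lookup w q ∷ lookup w r ∷ [] ⊆ w
entries₃-⊆ (x ∷ w) Fin.zero    (Fin.suc q) (Fin.suc r) _         (s≤s q<r) =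
  refl ∷ entries₂-⊆ w q r q<r
entries₃-⊆ (x ∷ w) (Fin.suc p) (Fin.suc q) (Fin.suc r) (s≤s p<q) (s≤s q<r) =
  x ∷ʳ entries₃-⊆ w p q r p<q q<r

⊆-entries₁ : ∀ {c w} → c ∷ [] ⊆ w → Σ (Fin (length w)) λ r → lookup w r ≡ c
⊆-entries₁ s = index (to∈ s) , sym (lookup-index (to∈ s))

⊆-entries₂ : ∀ {b c w} → b ∷ c ∷ [] ⊆ w → Σ (Fin (length w)) λ q → Σ (Fin (length w)) λ r →
             q Fin.< r × lookup w q ≡ b × lookup w r ≡ c
⊆-entries₂ (y ∷ʳ s) with ⊆-entries₂ s
... | q , r , q<r , eq , er = Fin.suc q , Fin.suc r , s≤s q<r , eq , er
⊆-entries₂ (refl ∷ s) with ⊆-entries₁ s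
... | r , er = Fin.zero , Fin.suc r , s≤s z≤n , refl , er

⊆-entries₃ : ∀ {a b c w} → a ∷ b ∷ c ∷ [] ⊆ w →
             Σ (Fin (length w)) λ p → Σ (Fin (length w)) λ q → Σ (Fin (length w)) λ r →
             p Fin.< q × q Fin.< r × lookup w p ≡ a × lookup w q ≡ b × lookup w r ≡ c
⊆-entries₃ (y ∷ʳ s) with ⊆-entries₃ s
... | p , q , r , p<q , q<r , ep , eq , er =
  Fin.suc p , Fin.suc q , Fin.suc r , s≤s p<q , s≤s q<r , ep , eq , er
⊆-entries₃ (refl ∷ s) with ⊆-entries₂ s
... | q , r , q<r , eq , er = Fin.zero , Fin.suc q , Fin.suc r , s≤s z≤n , s≤s q<r , refl , eq , er

avoids212⇒stirling : ∀ w → Avoids212 w → StirlingCondition w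
avoids212⇒stirling w avoids p q r p<q q<r ep≡er =
  avoids _ _ (subst (λ c → lookup w p ∷ lookup w q ∷ c ∷ [] ⊆ w) (sym ep≡er)
                    (entries₃-⊆ w p q r p<q q<r))

stirling⇒avoids212 : ∀ w → StirlingCondition w → Avoids212 w
stirling⇒avoids212 w stirling a b s =
  let p , q , r , p<q , q<r , ep , eq , er = ⊆-entries₃ s
  in subst₂ _≤_ ep eq (stirling p q r p<q q<r (trans ep (sym er)))

skip-block : ∀ {L xs} u c v → L ∉ xs → xs ⊆ u ++ replicate c L ++ v → xs ⊆ u ++ v
skip-block (x ∷ u) c       v L∉xs (_ ∷ʳ s)   = x ∷ʳ skip-block u c v L∉xs s
skip-block (x ∷ u) c       v L∉xs (refl ∷ s) = refl ∷ skip-block u c v (L∉xs ∘ there) s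
skip-block []      zero    v L∉xs s          = s
skip-block []      (suc c) v L∉xs (_ ∷ʳ s)   = skip-block [] c v L∉xs s
skip-block []      (suc c) v L∉xs (refl ∷ s) = ⊥-elim (L∉xs (here refl))

block-start : ∀ {L b} c v → L ∉ v → b ∷ L ∷ [] ⊆ replicate c L ++ v → b ≡ L
block-start zero    v L∉v s          = ⊥-elim (L∉v (∈-resp-⊆ s (there (here refl))))
block-start (suc c) v L∉v (_ ∷ʳ s)   = block-start c v L∉v s
block-start (suc c) v L∉v (refl ∷ s) = refl

inside-block : ∀ {L b} u c v → L ∉ u → L ∉ v → L ∷ b ∷ L ∷ [] ⊆ u ++ replicate c L ++ v → b ≡ L
inside-block (x ∷ u) c       v L∉u L∉v (_ ∷ʳ s)   = inside-block u c v (L∉u ∘ there) L∉v s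
inside-block (x ∷ u) c       v L∉u L∉v (refl ∷ s) = ⊥-elim (L∉u (here refl))
inside-block []      zero    v L∉u L∉v s          = ⊥-elim (L∉v (∈-resp-⊆ s (here refl)))
inside-block []      (suc c) v L∉u L∉v (_ ∷ʳ s)   = inside-block [] c v L∉u L∉v s
inside-block []      (suc c) v L∉u L∉v (refl ∷ s) = block-start c v L∉v s

avoids212-insertBlock : ∀ {L} u c v → All (_< L) (u ++ v) → Avoids212 (u ++ v) →
                        Avoids212 (u ++ replicate c L ++ v)
avoids212-insertBlock {L} u c v bound avoids a b s with a ≟ L | b ≟ L
... | yes refl | _        = ≤-reflexive (sym (inside-block u c v (above-∉ bu) (above-∉ bv) s))
  where bu = proj₁ (All.++⁻ u bound); bv = proj₂ (All.++⁻ u bound)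
... | no _     | yes refl = All.lookup bounded (∈-resp-⊆ s (here refl))
  where
  bounded : All (_≤ L) (u ++ replicate c L ++ v)
  bounded = All.++⁺ (All.map <⇒≤ (proj₁ (All.++⁻ u bound)))
                    (All.++⁺ (All.replicate⁺ c ≤-refl) (All.map <⇒≤ (proj₂ (All.++⁻ u bound))))
... | no a≢L   | no b≢L   = avoids a b (skip-block u c v L∉pattern s)
  where
  L∉pattern : L ∉ a ∷ b ∷ a ∷ []
  L∉pattern = ∉-∷ a≢L (∉-∷ b≢L (∉-∷ a≢L λ ()))

leading-block : ∀ L w → Avoids212 (L ∷ w) → All (_≤ L) w →
                Σ ℕ λ c → Σ (List ℕ) λ v → w ≡ replicate c L ++ v × L ∉ v
leading-block L []      avoids []            = 0 , [] , refl , λ ()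
leading-block L (y ∷ w) avoids (y≤L ∷ bound) with y ≟ L
... | yes refl =
  let c , v , w≡ , L∉v = leading-block L w (avoids212-⊆ (refl ∷ L ∷ʳ ⊆-refl) avoids) bound
  in suc c , v , cong (L ∷_) w≡ , L∉v
... | no y≢L = 0 , y ∷ w , refl , ∉-∷ y≢L L∉w
  where
  -- an L after y < L would complete the forbidden pattern L y L
  L∉w : L ∉ w
  L∉w L∈w = <-irrefl refl (<-≤-trans (≤∧≢⇒< y≤L y≢L) (avoids L y (refl ∷ refl ∷ from∈ L∈w)))

maximum-block : ∀ L w → Avoids212 w → All (_≤ L) w → L ∈ w →
                Σ (List ℕ) λ u → Σ ℕ λ c → Σ (List ℕ) λ v →
                w ≡ u ++ L ∷ replicate c L ++ v × L ∉ u × L ∉ v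
maximum-block L (x ∷ w) avoids (x≤L ∷ bound) L∈ with x ≟ L
... | yes refl = let c , v , w≡ , L∉v = leading-block L w avoids bound
                 in [] , c , v , cong (L ∷_) w≡ , (λ ()) , L∉v
... | no x≢L =
  let u , c , v , w≡ , L∉u , L∉v =
        maximum-block L w (avoids212-⊆ (x ∷ʳ ⊆-refl) avoids) bound
                      (∈-++-right (x ∷ []) (∉-∷ x≢L λ ()) L∈)
  in x ∷ u , c , v , cong (x ∷_) w≡ , ∉-∷ x≢L L∉u , L∉v

block-size : ∀ {L : ℕ} (xs ys : List ℕ) c d → L ∉ xs → L ∉ ys →
             xs ++ replicate c L ↭ ys ++ replicate d L → c ≡ d × xs ↭ ys
block-size xs ys zero    zero    _    _    π =
  refl , ↭-trans (↭-reflexive (sym (++-identityʳ xs))) (↭-trans π (↭-reflexive (++-identityʳ ys)))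
block-size xs ys zero    (suc d) L∉xs _    π =
  ⊥-elim (∉-++ xs L∉xs (λ ()) (∈-resp-↭ (↭-sym π) (∈-++⁺ʳ ys (here refl))))
block-size xs ys (suc c) zero    _    L∉ys π =
  ⊥-elim (∉-++ ys L∉ys (λ ()) (∈-resp-↭ π (∈-++⁺ʳ xs (here refl))))
block-size {L} xs ys (suc c) (suc d) L∉xs L∉ys π =
  let c≡d , xs↭ys = block-size xs ys c d L∉xs L∉ys
                      (drop-∷ (↭-trans (↭-sym (shift L xs (replicate c L)))
                              (↭-trans π (shift L ys (replicate d L)))))
  in cong suc c≡d , xs↭ys

insertBlock : ℕ → ℕ → ℕ → List ℕ → List ℕ
insertBlock c L p w = take p w ++ L ∷ replicate c L ++ drop p w

removeBlock : ℕ → ℕ → List ℕ → List ℕ × ℕ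
removeBlock c L []      = [] , 0
removeBlock c L (x ∷ w) with x ≟ L
... | yes _ = drop c w , 0
... | no  _ = Product.map (x ∷_) suc (removeBlock c L w)

drop-replicate : ∀ c (L : ℕ) v → drop c (replicate c L ++ v) ≡ v
drop-replicate zero    L v = refl
drop-replicate (suc c) L v = drop-replicate c L v

removeBlock-split : ∀ c L u v → L ∉ u →
                    removeBlock c L (u ++ L ∷ replicate c L ++ v) ≡ (u ++ v , length u)
removeBlock-split c L [] v _ with L ≟ L
... | yes _   = cong (_, 0) (drop-replicate c L v)
... | no  L≢L = ⊥-elim (L≢L refl)
removeBlock-split c L (x ∷ u) v L∉xu with x ≟ L
... | yes x≡L = ⊥-elim (L∉xu (here (sym x≡L)))
... | no  _   = cong (Product.map (x ∷_) suc) (removeBlock-split c L u v (L∉xu ∘ there))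

insertBlock-split : ∀ c L u v → insertBlock c L (length u) (u ++ v) ≡ u ++ L ∷ replicate c L ++ v
insertBlock-split c L []      v = refl
insertBlock-split c L (x ∷ u) v = cong (x ∷_) (insertBlock-split c L u v)

removeBlock-insertBlock : ∀ c L w p → L ∉ w → p ≤ length w →
                          removeBlock c L (insertBlock c L p w) ≡ (w , p)
removeBlock-insertBlock c L w p L∉w p≤len = begin
  removeBlock c L (take p w ++ L ∷ replicate c L ++ drop p w)
    ≡⟨ removeBlock-split c L (take p w) (drop p w) L∉take ⟩
  (take p w ++ drop p w , length (take p w))
    ≡⟨ cong₂ _,_ (take++drop≡id p w) (trans (length-take p w) (m≤n⇒m⊓n≡m p≤len)) ⟩
  (w , p) ∎
  where
  open ≡-Reasoning
  L∉take : L ∉ take p w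
  L∉take L∈ = L∉w (subst (L ∈_) (take++drop≡id p w) (∈-++⁺ˡ L∈))

stirlingMultiset-step : ∀ k m →
  stirlingMultiset k (2 + m) ≡ stirlingMultiset k (1 + m) ++ replicate (k + 2) (2 + m)
stirlingMultiset-step k m = begin
  replicate k 1 ++ concatMap block (map shift2 (upTo (suc m)))
    ≡⟨ cong (λ is → replicate k 1 ++ concatMap block (map shift2 is)) (sym (upTo-∷ʳ m)) ⟩
  replicate k 1 ++ concatMap block (map shift2 (upTo m ++ m ∷ []))
    ≡⟨ cong (λ is → replicate k 1 ++ concatMap block is) (map-++ shift2 (upTo m) (m ∷ [])) ⟩
  replicate k 1 ++ concatMap block (map shift2 (upTo m) ++ 2 + m ∷ [])
    ≡⟨ cong (replicate k 1 ++_) (concatMap-++ block (map shift2 (upTo m)) (2 + m ∷ [])) ⟩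
  replicate k 1 ++ (concatMap block (map shift2 (upTo m)) ++ block (2 + m) ++ [])
    ≡⟨ cong (λ b → replicate k 1 ++ (concatMap block (map shift2 (upTo m)) ++ b))
            (++-identityʳ (block (2 + m))) ⟩
  replicate k 1 ++ (concatMap block (map shift2 (upTo m)) ++ block (2 + m))
    ≡⟨ sym (++-assoc (replicate k 1) _ _) ⟩
  (replicate k 1 ++ concatMap block (map shift2 (upTo m))) ++ block (2 + m) ∎
  where
  open ≡-Reasoning
  block : ℕ → List ℕ
  block i = replicate (k + 2) i
  shift2 : ℕ → ℕ
  shift2 i = 2 + i

stirlingMultiset-bound : ∀ k m → All (_< 2 + m) (stirlingMultiset k (1 + m))
stirlingMultiset-bound k zero    = All.++⁺ (All.replicate⁺ k (s≤s (s≤s z≤n))) []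
stirlingMultiset-bound k (suc m) rewrite stirlingMultiset-step k m =
  All.++⁺ (All.map m<n⇒m<1+n (stirlingMultiset-bound k m)) (All.replicate⁺ (k + 2) (n<1+n _))

stirlingMultiset-slots : ∀ k m → suc (length (stirlingMultiset k (1 + m))) ≡ slotCount k m
stirlingMultiset-slots k zero    =
  cong suc (trans (cong length (++-identityʳ (replicate k 1))) (length-replicate k))
stirlingMultiset-slots k (suc m) = begin
  suc (length (stirlingMultiset k (2 + m)))
    ≡⟨ cong (suc ∘ length) (stirlingMultiset-step k m) ⟩
  suc (length (stirlingMultiset k (1 + m) ++ replicate (k + 2) (2 + m)))
    ≡⟨ cong suc (trans (length-++ (stirlingMultiset k (1 + m)))
                       (cong (length (stirlingMultiset k (1 + m)) +_) (length-replicate (k + 2)))) ⟩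
  suc (length (stirlingMultiset k (1 + m))) + (k + 2)
    ≡⟨ cong₂ _+_ (stirlingMultiset-slots k m) (+-comm k 2) ⟩
  slotCount k m + suc (suc k) ∎
  where open ≡-Reasoning

block-shape : ∀ k (L : ℕ) → replicate (k + 2) L ≡ L ∷ replicate (suc k) L
block-shape k L rewrite +-comm k 2 = refl

constant-list : ∀ (x : ℕ) w → All (_≡ x) w → w ≡ replicate (length w) x
constant-list x []      []           = refl
constant-list x (y ∷ w) (refl ∷ eqs) = cong (x ∷_) (constant-list x w eqs)

module _ (k : ℕ) where

  StirlingWord : ℕ → List ℕ → Set
  StirlingWord m = IsBundledStirling k (suc m)

  stirlingWord-bound : ∀ m {w} → StirlingWord m w → All (_< 2 + m) w
  stirlingWord-bound m (π , _) = All-resp-↭ (↭-sym π) (stirlingMultiset-bound k m)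

  stirlingWord-slots : ∀ m {w} → StirlingWord m w → slotCount k m ≡ suc (length w)
  stirlingWord-slots m (π , _) =
    trans (sym (stirlingMultiset-slots k m)) (cong suc (sym (↭-length π)))

  stirlingWord-seed : StirlingWord 0 (replicate k 1)
  stirlingWord-seed = ↭-reflexive (sym (++-identityʳ (replicate k 1))) , avoids212⇒stirling _ avoids
    where
    ones : ∀ {x} → x ∈ replicate k 1 → x ≡ 1
    ones = All.lookup (All.replicate⁺ {P = _≡ 1} k refl)
    avoids : Avoids212 (replicate k 1)
    avoids a b s = ≤-reflexive (trans (ones (∈-resp-⊆ s (here refl)))
                                      (sym (ones (∈-resp-⊆ s (there (here refl))))))

  stirlingWord-seed-unique : ∀ {w} → StirlingWord 0 w → w ≡ replicate k 1
  stirlingWord-seed-unique {w} valid@(π , _) = begin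
    w                        ≡⟨ constant-list 1 w (All-resp-↭ (↭-sym π) (All.++⁺ (All.replicate⁺ k refl) [])) ⟩
    replicate (length w) 1   ≡⟨ cong (λ n → replicate n 1) (sym (cong pred (stirlingWord-slots 0 valid))) ⟩
    replicate k 1            ∎
    where open ≡-Reasoning

  stirlingWord-insert : ∀ m {p w} → StirlingWord m w → p < slotCount k m →
                        StirlingWord (suc m) (insertBlock (suc k) (2 + m) p w)
  stirlingWord-insert m {p} {w} valid@(π , stirling) p<slots = π′ , avoids212⇒stirling _ avoids
    where
    L = 2 + m
    B = L ∷ replicate (suc k) L
    split = take++drop≡id p w
    π′ : take p w ++ B ++ drop p w ↭ stirlingMultiset k (2 + m)
    π′ = ↭-trans (shifts (take p w) B)
         (↭-trans (↭-++⁺ˡ B (↭-reflexive split))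
         (↭-trans (++-comm B w)
         (↭-trans (↭-++⁺ʳ B π)
         (↭-reflexive (sym (trans (stirlingMultiset-step k m)
                                  (cong (stirlingMultiset k (1 + m) ++_) (block-shape k L))))))))
    avoids : Avoids212 (take p w ++ replicate (suc (suc k)) L ++ drop p w)
    avoids = avoids212-insertBlock (take p w) (suc (suc k)) (drop p w)
               (subst (All (_< L)) (sym split) (stirlingWord-bound m valid))
               (subst Avoids212 (sym split) (stirling⇒avoids212 w stirling))

  stirlingWord-split : ∀ m {w} → StirlingWord (suc m) w →
                       Σ (List ℕ) λ u → Σ (List ℕ) λ v →
                       w ≡ u ++ 2 + m ∷ replicate (suc k) (2 + m) ++ v × 2 + m ∉ u ×
                       StirlingWord m (u ++ v)
  stirlingWord-split m {w} (π , stirling) =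
    let u , c , v , w≡ , L∉u , L∉v = maximum-block L w avoids bounded L∈w
        π₁ : (u ++ v) ++ replicate (suc c) L ↭ M ++ replicate (k + 2) L
        π₁ = ↭-trans (↭-reflexive (++-assoc u v _))
             (↭-trans (↭-++⁺ˡ u (++-comm v (L ∷ replicate c L)))
             (↭-trans (subst (_↭ _) w≡ π) (↭-reflexive (stirlingMultiset-step k m))))
        sc≡ , π₂ = block-size (u ++ v) M (suc c) (k + 2) (∉-++ u L∉u L∉v)
                     (above-∉ (stirlingMultiset-bound k m)) π₁
        c≡ : c ≡ suc k
        c≡ = cong pred (trans sc≡ (+-comm k 2))
        avoids′ : Avoids212 (u ++ v)
        avoids′ = avoids212-⊆ (++⁺ ⊆-refl (++⁺ˡ (L ∷ replicate c L) ⊆-refl))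
                              (subst Avoids212 w≡ avoids)
    in u , v , trans w≡ (cong (λ c → u ++ L ∷ replicate c L ++ v) c≡) , L∉u ,
       π₂ , avoids212⇒stirling (u ++ v) avoids′
    where
    L = 2 + m
    M = stirlingMultiset k (1 + m)
    avoids = stirling⇒avoids212 w stirling
    top : All (_≤ L) (stirlingMultiset k (2 + m))
    top = subst (All (_≤ L)) (sym (stirlingMultiset-step k m))
            (All.++⁺ (All.map <⇒≤ (stirlingMultiset-bound k m)) (All.replicate⁺ (k + 2) ≤-refl))
    bounded : All (_≤ L) w
    bounded = All-resp-↭ (↭-sym π) top
    L∈w : L ∈ w
    L∈w = ∈-resp-↭ (↭-sym π) (subst (L ∈_) (sym (stirlingMultiset-step k m))
            (∈-++⁺ʳ M (subst (L ∈_) (sym (block-shape k L)) (here refl))))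

  wordScheme : GrowthScheme (List ℕ) (slotCount k)
  wordScheme = record
    { Valid         = StirlingWord
    ; seed          = replicate k 1
    ; seed-valid    = stirlingWord-seed
    ; seed-unique   = stirlingWord-seed-unique
    ; insert        = λ m → insertBlock (suc k) (2 + m)
    ; remove        = λ m → removeBlock (suc k) (2 + m)
    ; insert-valid  = λ {m} → stirlingWord-insert m
    ; remove-insert = λ {m} {p} {w} valid p<slots →
        removeBlock-insertBlock (suc k) (2 + m) w p (above-∉ (stirlingWord-bound m valid))
          (≤-pred (subst (p <_) (stirlingWord-slots m valid) p<slots))
    ; remove-valid  = removeBlock-valid
    ; insert-remove = insertBlock-removeBlock
    }
    where
    ≤-pred : ∀ {p n} → p < suc n → p ≤ n
    ≤-pred (s≤s p≤n) = p≤n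
    removeBlock-valid : ∀ {m w} → StirlingWord (suc m) w →
                   StirlingWord m (proj₁ (removeBlock (suc k) (2 + m) w)) ×
                   proj₂ (removeBlock (suc k) (2 + m) w) < slotCount k m
    removeBlock-valid {m} valid with stirlingWord-split m valid
    ... | u , v , refl , L∉u , valid′ rewrite removeBlock-split (suc k) (2 + m) u v L∉u =
      valid′ , subst (length u <_) (sym (stirlingWord-slots m valid′))
                 (s≤s (subst (length u ≤_) (sym (length-++ u)) (m≤m+n _ _)))
    insertBlock-removeBlock : ∀ {m w} → StirlingWord (suc m) w →
                    insertBlock (suc k) (2 + m) (proj₂ (removeBlock (suc k) (2 + m) w))
                      (proj₁ (removeBlock (suc k) (2 + m) w)) ≡ w
    insertBlock-removeBlock {m} valid with stirlingWord-split m valid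
    ... | u , v , refl , L∉u , _ rewrite removeBlock-split (suc k) (2 + m) u v L∉u =
      insertBlock-split (suc k) (2 + m) u v

Bundles : ℕ → ℕ → Set
Bundles b n = Vec (List (BTree b)) n

module _ {b : ℕ} where

  leaf : ℕ → BTree b
  leaf m = node m (Vec.replicate b [])

  -- Gaps are the places where a new leaf can be attached: a list of c subtrees
  -- has c + 1 gaps of its own, plus the gaps inside its subtrees.
  mutual
    gapsV : ∀ {n} → Bundles b n → ℕ
    gapsV []       = 0
    gapsV (l ∷ bs) = gapsL l + gapsV bs

    gapsL : List (BTree b) → ℕ
    gapsL []               = 1
    gapsL (node a bs ∷ ts) = suc (gapsV bs + gapsL ts)

  -- attach p m: put a leaf labelled m into gap number p.  Gap 0 of a list is in
  -- front of its first subtree; the next gapsV bs gaps lie inside that subtree.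
  mutual
    attachL : ℕ → ℕ → List (BTree b) → List (BTree b)
    attachL zero    m ts               = leaf m ∷ ts
    attachL (suc p) m []               = []
    attachL (suc p) m (node a bs ∷ ts) with p <? gapsV bs
    ... | yes _ = node a (attachV p m bs) ∷ ts
    ... | no  _ = node a bs ∷ attachL (p ∸ gapsV bs) m ts

    attachV : ∀ {n} → ℕ → ℕ → Bundles b n → Bundles b n
    attachV p m []       = []
    attachV p m (l ∷ bs) with p <? gapsL l
    ... | yes _ = attachL p m l ∷ bs
    ... | no  _ = l ∷ attachV (p ∸ gapsL l) m bs

  mutual
    detachL : ℕ → List (BTree b) → List (BTree b) × ℕ
    detachL m []               = [] , 0
    detachL m (node a bs ∷ ts) with a ≟ m
    ... | yes _ = ts , 0
    ... | no  _ with m ∈? labelsV bs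
    ...   | yes _ = Product.map (λ bs′ → node a bs′ ∷ ts) suc (detachV m bs)
    ...   | no  _ = Product.map (node a bs ∷_) (λ p → suc (gapsV bs + p)) (detachL m ts)

    detachV : ∀ {n} → ℕ → Bundles b n → Bundles b n × ℕ
    detachV m []       = [] , 0
    detachV m (l ∷ bs) with m ∈? labelsL l
    ... | yes _ = Product.map (_∷ bs) id (detachL m l)
    ... | no  _ = Product.map (l ∷_) (gapsL l +_) (detachV m bs)

  gapsV-replicate : ∀ n → gapsV (Vec.replicate n []) ≡ n
  gapsV-replicate zero    = refl
  gapsV-replicate (suc n) = cong suc (gapsV-replicate n)

  labelsV-replicate : ∀ n → labelsV {b} (Vec.replicate n []) ≡ []
  labelsV-replicate zero    = refl
  labelsV-replicate (suc n) = labelsV-replicate n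

  increasingV-replicate : ∀ a n → IncreasingV {b} a (Vec.replicate n [])
  increasingV-replicate a zero    = tt
  increasingV-replicate a (suc n) = tt , increasingV-replicate a n

  gapsL-positive : ∀ ts → 0 < gapsL ts
  gapsL-positive []             = s≤s z≤n
  gapsL-positive (node _ _ ∷ _) = s≤s z≤n

  gap-beyond : ∀ {g p n} → ¬ p < g → p < g + n → p ∸ g < n
  gap-beyond {g} {p} {n} p≮g p<g+n =
    +-cancelˡ-< g (p ∸ g) n (subst (_< g + n) (sym (m+[n∸m]≡n (≮⇒≥ p≮g))) p<g+n)

  attachL-inside : ∀ {p m a ts} (bs : Bundles b b) → p < gapsV bs →
                   attachL (suc p) m (node a bs ∷ ts) ≡ node a (attachV p m bs) ∷ ts
  attachL-inside {p} bs p<g with p <? gapsV bs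
  ... | yes _   = refl
  ... | no  p≮g = ⊥-elim (p≮g p<g)

  attachL-beyond : ∀ {p m a ts} (bs : Bundles b b) →
                   attachL (suc (gapsV bs + p)) m (node a bs ∷ ts) ≡ node a bs ∷ attachL p m ts
  attachL-beyond {p} {m} {a} {ts} bs with gapsV bs + p <? gapsV bs
  ... | yes g+p<g = ⊥-elim (≤⇒≯ (m≤m+n (gapsV bs) p) g+p<g)
  ... | no  _     = cong (λ q → node a bs ∷ attachL q m ts) (m+n∸m≡n (gapsV bs) p)

  attachV-inside : ∀ {p m n l} {bs : Bundles b n} → p < gapsL l →
                   attachV p m (l ∷ bs) ≡ attachL p m l ∷ bs
  attachV-inside {p} {l = l} p<g with p <? gapsL l
  ... | yes _   = refl
  ... | no  p≮g = ⊥-elim (p≮g p<g)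

  attachV-beyond : ∀ {p m n} l {bs : Bundles b n} →
                   attachV (gapsL l + p) m (l ∷ bs) ≡ l ∷ attachV p m bs
  attachV-beyond {p} {m} l {bs} with gapsL l + p <? gapsL l
  ... | yes g+p<g = ⊥-elim (≤⇒≯ (m≤m+n (gapsL l) p) g+p<g)
  ... | no  _     = cong (λ q → l ∷ attachV q m bs) (m+n∸m≡n (gapsL l) p)

  -- A new leaf adds its own b + 1 gaps (b empty bundles, plus one more in its list).
  mutual
    gapsL-attach : ∀ m p ts → p < gapsL ts → gapsL (attachL p m ts) ≡ gapsL ts + suc b
    gapsL-attach m zero ts _ rewrite gapsV-replicate b =
      trans (cong suc (+-comm b (gapsL ts))) (sym (+-suc (gapsL ts) b))
    gapsL-attach m (suc p) [] (s≤s ())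
    gapsL-attach m (suc p) (node a bs ∷ ts) (s≤s p<) with p <? gapsV bs
    ... | yes p<g rewrite gapsV-attach m p bs p<g =
      cong suc (xy∙z≈xz∙y (gapsV bs) (suc b) (gapsL ts))
    ... | no  p≮g rewrite gapsL-attach m (p ∸ gapsV bs) ts (gap-beyond p≮g p<) =
      cong suc (sym (+-assoc (gapsV bs) (gapsL ts) (suc b)))

    gapsV-attach : ∀ {n} m p (bs : Bundles b n) → p < gapsV bs →
                   gapsV (attachV p m bs) ≡ gapsV bs + suc b
    gapsV-attach m p (l ∷ bs) p< with p <? gapsL l
    ... | yes p<g rewrite gapsL-attach m p l p<g = xy∙z≈xz∙y (gapsL l) (suc b) (gapsV bs)
    ... | no  p≮g rewrite gapsV-attach m (p ∸ gapsL l) bs (gap-beyond p≮g p<) =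
      sym (+-assoc (gapsL l) (gapsV bs) (suc b))

  mutual
    labelsL-attach : ∀ m p ts → p < gapsL ts → labelsL (attachL p m ts) ↭ m ∷ labelsL ts
    labelsL-attach m zero ts _ rewrite labelsV-replicate b = ↭-refl
    labelsL-attach m (suc p) [] (s≤s ())
    labelsL-attach m (suc p) (node a bs ∷ ts) (s≤s p<) with p <? gapsV bs
    ... | yes p<g = ↭-trans (↭-++⁺ʳ (labelsL ts) (↭-prep a (labelsV-attach m p bs p<g)))
                            (↭-swap a m ↭-refl)
    ... | no  p≮g = ↭-trans (↭-++⁺ˡ (a ∷ labelsV bs)
                                    (labelsL-attach m (p ∸ gapsV bs) ts (gap-beyond p≮g p<)))
                            (shift m (a ∷ labelsV bs) (labelsL ts))

    labelsV-attach : ∀ {n} m p (bs : Bundles b n) → p < gapsV bs →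
                     labelsV (attachV p m bs) ↭ m ∷ labelsV bs
    labelsV-attach m p (l ∷ bs) p< with p <? gapsL l
    ... | yes p<g = ↭-++⁺ʳ (labelsV bs) (labelsL-attach m p l p<g)
    ... | no  p≮g = ↭-trans (↭-++⁺ˡ (labelsL l)
                                    (labelsV-attach m (p ∸ gapsL l) bs (gap-beyond p≮g p<)))
                            (shift m (labelsL l) (labelsV bs))

  attachedL-∈ : ∀ m p ts → p < gapsL ts → m ∈ labelsL (attachL p m ts)
  attachedL-∈ m p ts p< = ∈-resp-↭ (↭-sym (labelsL-attach m p ts p<)) (here refl)

  attachedV-∈ : ∀ {n} m p (bs : Bundles b n) → p < gapsV bs → m ∈ labelsV (attachV p m bs)
  attachedV-∈ m p bs p< = ∈-resp-↭ (↭-sym (labelsV-attach m p bs p<)) (here refl)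

  mutual
    increasingL-attach : ∀ a m p ts → All (_< m) (a ∷ labelsL ts) →
                         IncreasingL a ts → IncreasingL a (attachL p m ts)
    increasingL-attach a m zero    ts (a<m ∷ _) inc = a<m , increasingV-replicate m b , inc
    increasingL-attach a m (suc p) []  _ _ = tt
    increasingL-attach a m (suc p) (node a′ bs ∷ ts) (a<m ∷ a′<m ∷ bound) (a<a′ , incV , incL)
      with p <? gapsV bs
    ... | yes _ = a<a′ , increasingV-attach a′ m p bs (a′<m ∷ proj₁ (All.++⁻ (labelsV bs) bound)) incV ,
                  incL
    ... | no  _ = a<a′ , incV ,
                  increasingL-attach a m (p ∸ gapsV bs) ts (a<m ∷ proj₂ (All.++⁻ (labelsV bs) bound)) incL

    increasingV-attach : ∀ {n} a m p (bs : Bundles b n) → All (_< m) (a ∷ labelsV bs) →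
                         IncreasingV a bs → IncreasingV a (attachV p m bs)
    increasingV-attach a m p []       _ _ = tt
    increasingV-attach a m p (l ∷ bs) (a<m ∷ bound) (incL , incV) with p <? gapsL l
    ... | yes _ = increasingL-attach a m p l (a<m ∷ proj₁ (All.++⁻ (labelsL l) bound)) incL , incV
    ... | no  _ = incL , increasingV-attach a m (p ∸ gapsL l) bs (a<m ∷ proj₂ (All.++⁻ (labelsL l) bound)) incV

  mutual
    increasingL-attach⁻ : ∀ a m p ts → IncreasingL a (attachL p m ts) → IncreasingL a ts
    increasingL-attach⁻ a m zero    ts (_ , _ , inc) = inc
    increasingL-attach⁻ a m (suc p) [] _ = tt
    increasingL-attach⁻ a m (suc p) (node a′ bs ∷ ts) inc with p <? gapsV bs | inc
    ... | yes _ | a<a′ , incV , incL = a<a′ , increasingV-attach⁻ a′ m p bs incV , incL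
    ... | no  _ | a<a′ , incV , incL = a<a′ , incV , increasingL-attach⁻ a m (p ∸ gapsV bs) ts incL

    increasingV-attach⁻ : ∀ {n} a m p (bs : Bundles b n) → IncreasingV a (attachV p m bs) →
                          IncreasingV a bs
    increasingV-attach⁻ a m p []       _   = tt
    increasingV-attach⁻ a m p (l ∷ bs) inc with p <? gapsL l | inc
    ... | yes _ | incL , incV = increasingL-attach⁻ a m p l incL , incV
    ... | no  _ | incL , incV = incL , increasingV-attach⁻ a m (p ∸ gapsL l) bs incV

  mutual
    detachL-attachL : ∀ m p ts → m ∉ labelsL ts → p < gapsL ts →
                      detachL m (attachL p m ts) ≡ (ts , p)
    detachL-attachL m zero ts _ _ with m ≟ m
    ... | yes _   = refl
    ... | no  m≢m = ⊥-elim (m≢m refl)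
    detachL-attachL m (suc p) [] _ (s≤s ())
    detachL-attachL m (suc p) (node a bs ∷ ts) m∉ (s≤s p<) with p <? gapsV bs
    ... | yes p<g with a ≟ m
    ...   | yes a≡m = ⊥-elim (m∉ (here (sym a≡m)))
    ...   | no  _ with m ∈? labelsV (attachV p m bs)
    ...     | yes _  = cong (Product.map (λ bs′ → node a bs′ ∷ ts) suc)
                            (detachV-attachV m p bs (m∉ ∘ there ∘ ∈-++⁺ˡ) p<g)
    ...     | no m∉′ = ⊥-elim (m∉′ (attachedV-∈ m p bs p<g))
    detachL-attachL m (suc p) (node a bs ∷ ts) m∉ (s≤s p<) | no p≮g with a ≟ m
    ...   | yes a≡m = ⊥-elim (m∉ (here (sym a≡m)))
    ...   | no  _ with m ∈? labelsV bs
    ...     | yes m∈ = ⊥-elim (m∉ (there (∈-++⁺ˡ m∈)))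
    ...     | no  _  = trans
      (cong (Product.map (node a bs ∷_) (λ q → suc (gapsV bs + q)))
            (detachL-attachL m (p ∸ gapsV bs) ts (m∉ ∘ ∈-++⁺ʳ (a ∷ labelsV bs)) (gap-beyond p≮g p<)))
      (cong (λ q → node a bs ∷ ts , suc q) (m+[n∸m]≡n (≮⇒≥ p≮g)))

    detachV-attachV : ∀ {n} m p (bs : Bundles b n) → m ∉ labelsV bs → p < gapsV bs →
                      detachV m (attachV p m bs) ≡ (bs , p)
    detachV-attachV m p (l ∷ bs) m∉ p< with p <? gapsL l
    ... | yes p<g with m ∈? labelsL (attachL p m l)
    ...   | yes _  = cong (Product.map (_∷ bs) id) (detachL-attachL m p l (m∉ ∘ ∈-++⁺ˡ) p<g)
    ...   | no m∉′ = ⊥-elim (m∉′ (attachedL-∈ m p l p<g))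
    detachV-attachV m p (l ∷ bs) m∉ p< | no p≮g with m ∈? labelsL l
    ...   | yes m∈ = ⊥-elim (m∉ (∈-++⁺ˡ m∈))
    ...   | no  _  = trans
      (cong (Product.map (l ∷_) (gapsL l +_))
            (detachV-attachV m (p ∸ gapsL l) bs (m∉ ∘ ∈-++⁺ʳ (labelsL l)) (gap-beyond p≮g p<)))
      (cong (l ∷ bs ,_) (m+[n∸m]≡n (≮⇒≥ p≮g)))

  leaf-shape : ∀ {n} a (bs : Bundles b n) → IncreasingV a bs → All (_≤ a) (labelsV bs) →
               bs ≡ Vec.replicate n []
  leaf-shape a []                   _               _         = refl
  leaf-shape a ([] ∷ bs)            (_ , inc)       bound     = cong ([] ∷_) (leaf-shape a bs inc bound)
  leaf-shape a ((node r _ ∷ _) ∷ _) ((a<r , _) , _) (r≤a ∷ _) =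
    ⊥-elim (<-irrefl refl (<-≤-trans a<r r≤a))

  mutual
    attachL-detachL : ∀ a m ts → IncreasingL a ts → All (_≤ m) (labelsL ts) → m ∈ labelsL ts →
                      attachL (proj₂ (detachL m ts)) m (proj₁ (detachL m ts)) ≡ ts ×
                      proj₂ (detachL m ts) < gapsL (proj₁ (detachL m ts))
    attachL-detachL a m (node a′ bs ∷ ts) (_ , incV , incL) (_ ∷ bound) m∈ with a′ ≟ m
    ... | yes refl =
      cong (λ bs′ → node m bs′ ∷ ts) (sym (leaf-shape m bs incV (proj₁ (All.++⁻ (labelsV bs) bound)))) ,
      gapsL-positive ts
    ... | no a′≢m with m ∈? labelsV bs
    ...   | yes m∈bs with detachV m bs | attachV-detachV a′ m bs incV (proj₁ (All.++⁻ (labelsV bs) bound)) m∈bs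
    ...     | bs′ , p | bs≡ , p< =
      trans (attachL-inside bs′ p<) (cong (λ bs″ → node a′ bs″ ∷ ts) bs≡) ,
      s≤s (<-≤-trans p< (m≤m+n _ _))
    attachL-detachL a m (node a′ bs ∷ ts) (_ , incV , incL) (_ ∷ bound) m∈ | no a′≢m | no m∉bs
      with detachL m ts
         | attachL-detachL a m ts incL (proj₂ (All.++⁻ (labelsV bs) bound))
                           (∈-++-right (a′ ∷ labelsV bs) (∉-∷ a′≢m m∉bs) m∈)
    ... | ts′ , p | ts≡ , p< =
      trans (attachL-beyond bs) (cong (node a′ bs ∷_) ts≡) , s≤s (+-monoʳ-< (gapsV bs) p<)

    attachV-detachV : ∀ {n} a m (bs : Bundles b n) → IncreasingV a bs → All (_≤ m) (labelsV bs) →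
                      m ∈ labelsV bs →
                      attachV (proj₂ (detachV m bs)) m (proj₁ (detachV m bs)) ≡ bs ×
                      proj₂ (detachV m bs) < gapsV (proj₁ (detachV m bs))
    attachV-detachV a m (l ∷ bs) (incL , incV) bound m∈ with m ∈? labelsL l
    ... | yes m∈l with detachL m l | attachL-detachL a m l incL (proj₁ (All.++⁻ (labelsL l) bound)) m∈l
    ...   | l′ , p | l≡ , p< = trans (attachV-inside p<) (cong (_∷ bs) l≡) , <-≤-trans p< (m≤m+n _ _)
    attachV-detachV a m (l ∷ bs) (incL , incV) bound m∈ | no m∉l
      with detachV m bs
         | attachV-detachV a m bs incV (proj₂ (All.++⁻ (labelsL l) bound)) (∈-++-right (labelsL l) m∉l m∈)
    ... | bs′ , p | bs≡ , p< = trans (attachV-beyond l) (cong (l ∷_) bs≡) , +-monoʳ-< (gapsL l) p<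

  gaps : BTree b → ℕ
  gaps (node _ bs) = gapsV bs

  attach : ℕ → ℕ → BTree b → BTree b
  attach p m (node a bs) = node a (attachV p m bs)

  detach : ℕ → BTree b → BTree b × ℕ
  detach m (node a bs) = Product.map₁ (node a) (detachV m bs)

  gaps-attach : ∀ m p t → p < gaps t → gaps (attach p m t) ≡ gaps t + suc b
  gaps-attach m p (node _ bs) = gapsV-attach m p bs

upTo-bound : ∀ n → All (_< n) (upTo n)
upTo-bound zero    = []
upTo-bound (suc n) rewrite sym (upTo-∷ʳ n) =
  All.++⁺ (All.map m<n⇒m<1+n (upTo-bound n)) (n<1+n n ∷ [])

oneTo-bound : ∀ n → All (_< suc n) (oneTo n)
oneTo-bound n = All.map⁺ (All.map s≤s (upTo-bound n))

oneTo-step : ∀ m → oneTo (2 + m) ≡ oneTo (1 + m) ++ 2 + m ∷ []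
oneTo-step m = trans (cong (map suc) (sym (upTo-∷ʳ (suc m)))) (map-++ suc (upTo (suc m)) (suc m ∷ []))

module _ (k : ℕ) where

  IncreasingTree : ℕ → BTree (suc k) → Set
  IncreasingTree m = IsBundledIncreasingTree (suc k) (suc m)

  increasingTree-bound : ∀ m {t} → IncreasingTree m t → All (_< 2 + m) (labels t)
  increasingTree-bound m (π , _) = All-resp-↭ (↭-sym π) (oneTo-bound (suc m))

  increasingTree-seed : IncreasingTree 0 (leaf 1)
  increasingTree-seed rewrite labelsV-replicate {suc k} (suc k) =
    ↭-refl , refl , increasingV-replicate 1 (suc k)

  increasingTree-seed-unique : ∀ {t} → IncreasingTree 0 t → t ≡ leaf 1
  increasingTree-seed-unique {node a bs} (π , refl , inc) =
    cong (node 1) (leaf-shape 1 bs inc (subst (All (_≤ 1)) (sym (cong (drop 1) (↭-singleton-inv π))) []))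

  increasingTree-insert : ∀ m {p t} → IncreasingTree m t → p < gaps t →
                          IncreasingTree (suc m) (attach p (2 + m) t)
  increasingTree-insert m {p} {node a bs} valid@(π , root , inc) p<gaps =
    π′ , root , increasingV-attach a L p bs (increasingTree-bound m valid) inc
    where
    L = 2 + m
    π′ : a ∷ labelsV (attachV p L bs) ↭ oneTo (2 + m)
    π′ = ↭-trans (↭-prep a (labelsV-attach L p bs p<gaps))
         (↭-trans (↭-swap a L ↭-refl)
         (↭-trans (↭-prep L π)
         (↭-trans (++-comm (L ∷ []) (oneTo (suc m))) (↭-reflexive (sym (oneTo-step m))))))

  increasingTree-remove-insert : ∀ m {p t} → IncreasingTree m t → p < gaps t →
                                 detach (2 + m) (attach p (2 + m) t) ≡ (t , p)
  increasingTree-remove-insert m {p} {node a bs} valid p<gaps =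
    cong (Product.map₁ (node a))
         (detachV-attachV (2 + m) p bs (above-∉ (All.tail (increasingTree-bound m valid))) p<gaps)

  increasingTree-split : ∀ m {t} → IncreasingTree (suc m) t →
                         IncreasingTree m (proj₁ (detach (2 + m) t)) ×
                         proj₂ (detach (2 + m) t) < gaps (proj₁ (detach (2 + m) t)) ×
                         attach (proj₂ (detach (2 + m) t)) (2 + m) (proj₁ (detach (2 + m) t)) ≡ t
  increasingTree-split m {node a bs} (π , root , inc)
    with detachV (2 + m) bs | attachV-detachV a (2 + m) bs inc bounded L∈bs
    where
    L = 2 + m
    bounded : All (_≤ L) (labelsV bs)
    bounded = All.map (λ { (s≤s l≤L) → l≤L }) (All.tail (All-resp-↭ (↭-sym π) (oneTo-bound (2 + m))))
    -- the root is 1, so L must sit strictly below it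
    L∈bs : L ∈ labelsV bs
    L∈bs = ∈-++-right (a ∷ []) (∉-∷ (λ a≡L → 1≢2+m (trans (sym root) a≡L)) λ ())
             (∈-resp-↭ (↭-sym π)
                       (subst (L ∈_) (sym (oneTo-step m)) (∈-++⁺ʳ (oneTo (suc m)) (here refl))))
      where 1≢2+m : 1 ≢ L
            1≢2+m ()
  ... | bs′ , p | bs≡ , p< =
    (π′ , root , increasingV-attach⁻ a (2 + m) p bs′ (subst (IncreasingV a) (sym bs≡) inc)) ,
    p< , cong (node a) bs≡
    where
    π′ : a ∷ labelsV bs′ ↭ oneTo (suc m)
    π′ = drop-∷ (↭-trans (↭-swap (2 + m) a ↭-refl)
         (↭-trans (↭-prep a (↭-sym (labelsV-attach (2 + m) p bs′ p<)))
         (↭-trans (↭-reflexive (cong (λ bs″ → a ∷ labelsV bs″) bs≡))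
         (↭-trans π
         (↭-trans (↭-reflexive (oneTo-step m)) (++-comm (oneTo (suc m)) (2 + m ∷ [])))))))

  increasingTree-gaps : ∀ m {t} → IncreasingTree m t → gaps t ≡ slotCount k m
  increasingTree-gaps zero    valid rewrite increasingTree-seed-unique valid = gapsV-replicate (suc k)
  increasingTree-gaps (suc m) {t} valid =
    let valid′ , p< , t≡ = increasingTree-split m valid
        t′ = proj₁ (detach (2 + m) t)
        p  = proj₂ (detach (2 + m) t)
    in begin
      gaps t                          ≡⟨ cong gaps (sym t≡) ⟩
      gaps (attach p (2 + m) t′)      ≡⟨ gaps-attach (2 + m) p t′ p< ⟩
      gaps t′ + suc (suc k)           ≡⟨ cong (_+ suc (suc k)) (increasingTree-gaps m valid′) ⟩
      slotCount k m + suc (suc k)     ∎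
    where open ≡-Reasoning

  treeScheme : GrowthScheme (BTree (suc k)) (slotCount k)
  treeScheme = record
    { Valid         = IncreasingTree
    ; seed          = leaf 1
    ; seed-valid    = increasingTree-seed
    ; seed-unique   = increasingTree-seed-unique
    ; insert        = λ m p → attach p (2 + m)
    ; remove        = λ m → detach (2 + m)
    ; insert-valid  = λ {m} valid p<slots → increasingTree-insert m valid (in-gaps m valid p<slots)
    ; remove-insert = λ {m} valid p<slots → increasingTree-remove-insert m valid (in-gaps m valid p<slots)
    ; remove-valid  = λ {m} {t} valid →
        let valid′ , p< , _ = increasingTree-split m valid
        in valid′ , subst (proj₂ (detach (2 + m) t) <_) (increasingTree-gaps m valid′) p<
    ; insert-remove = λ {m} valid → proj₂ (proj₂ (increasingTree-split m valid))
    }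
    where
    in-gaps : ∀ m {p t} → IncreasingTree m t → p < slotCount k m → p < gaps t
    in-gaps m {p} valid = subst (p <_) (sym (increasingTree-gaps m valid))

theorem3p13 : (k n : ℕ) → 1 ≤ k → 1 ≤ n →
    Bijection (BundledIncreasingTrees (suc k) n) (BundledStirlingPerms k n)
theorem3p13 k zero    _ ()
theorem3p13 k (suc m) _ _ = growthBijection (treeScheme k) (wordScheme k) m
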